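{- Let $k\ge4$, $G$, $\mathcal S$, $\mathcal Q$ and the token assignment be as described in the context. Every vertex that is a satellite of a star of $\mathcal Q$ or is critical receives at least $\frac{1-\alpha}{k-1}$ token. Moreover, every vertex receives at least $1-(k-1)\alpha$ token.
   Context: $G=(V,E)$ is a simple undirected graph, $k\ge4$ an integer. A star in $G$ is a subgraph that is a single vertex, a single edge, or a tree with exactly one vertex of degree $\ge2$ and all others of degree $1$; an $\ell$-star has exactly $\ell$ vertices, an $\ell^-$-star at most $\ell$, an $\ell^+$-star at least $\ell$. The center of a star is its vertex of maximum degree (in a $2$-star one vertex is designated as center, arbitrarily but fixed); the others are satellites. A $k^-$-star partition of $G$ is a collection of vertex-disjoint $k^-$-stars covering $V$. Operations on a partition $\mathcal S$ (critical vertices are vertices in a $2$-star of $\mathcal S$ or centers of $3$-stars of $\mathcal S$; separate critical vertices lie in different stars of $\mathcal S$): Op.1: for $\{u,v\}\in E$ with $u$ in a $2$-star and $v$ a satellite of a $4^+$-star centered at $c$, replace $\{c,v\}$ by $\{u,v\}$. Op.2: for a star $v_1$-$v_2\ldots v_\ell$ of $\mathcal S$ ($\ell\in\{2,3,4\}$, center $v_1$) and pairwise separate critical vertices $w_1,\dots,w_\ell$ outside it with $\{v_j,w_j\}\in E$, replace its edges by $\{v_j,w_j\}$. Op.3: for a $2$- or $3$-star $S=v_1$-$v_2\ldots v_\ell$ and a $2$-star $W=w_1$-$w_2\neq S$ with $w_1,w_2$ adjacent to $v_1$: if $k\ge5$ or $\ell=2$ replace $\{w_1,w_2\}$ by $\{w_1,v_1\},\{w_2,v_1\}$;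 if $k=4,\ell=3$ and some critical $w_3\notin V(S)\cup V(W)$ is adjacent to $v_j$, $j\in\{2,3\}$, replace $\{w_1,w_2\},\{v_1,v_j\}$ by $\{w_1,v_1\},\{w_2,v_1\},\{w_3,v_j\}$. Standing assumptions: $\mathcal S$ is a $k^-$-star partition of $G$ with the minimum possible number of $1$-stars among all $k^-$-star partitions of $G$ and to which none of Operations 1–3 is applicable (equivalently, a possible output of the paper's algorithm). $\mathcal Q$ is a fixed optimal $k^-$-star partition (minimum number of stars), with a fixed center for each of its $2$-stars. "Critical" is always with respect to $\mathcal S$. Let $\alpha=\frac{2k-3}{2k^2-4k+1}$. Tokens: the vertex of each $1$-star of $\mathcal Q$ gets $\alpha$. For a $j$-star $v_1$-$v_2\ldots v_j$ of $\mathcal Q$ with $2\le j\le k$: (1) if $v_1$ is critical, $v_1$ gets $\alpha$ and each $v_i$ ($i\ge2$) gets $\frac{1-\alpha}{j-1}$; (2) if $v_1$ is not critical but some satellite is, each $v_i$ ($i\ge2$) gets $\alpha$ and $v_1$ gets $1-(j-1)\alpha$; (3) if no vertex of it is critical, each vertex gets $\frac1j$. -}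

module Defs where

open import Level using (0ℓ)
open import Data.Nat as ℕ using (ℕ; zero; suc; _≤_; _∸_)
open import Data.Fin using (Fin)
open import Data.Fin.Properties using (_≟_)
open import Data.List using (List; length; filter)
open import Data.Bool.ListAction using (any)
open import Data.List using (allFin) public
open import Data.Bool using (Bool; true; false; _∧_; _∨_; not; if_then_else_)
open import Data.Product using (Σ; ∃; _×_; _,_)
open import Data.Sum using (_⊎_)
open import Data.Integer using (+_)
open import Data.Rational as ℚ using (ℚ; 0ℚ; 1ℚ)
open import Relation.Nullary using (¬_; Dec; does; yes; no)
open import Relation.Nullary.Decidable using (⌊_⌋; _×-dec_; _⊎-dec_)
open import Relation.Binary.PropositionalEquality using (_≡_; _≢_)

record Graph (n : ℕ) : Set₁ where
  field
    Adj   : Fin n → Fin n → Set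
    sym   : ∀ {u v} → Adj u v → Adj v u
    irrefl : ∀ {v} → ¬ Adj v v
open Graph public

-- A collection of vertex-disjoint stars covering V, each with a
-- designated center, is encoded by the map  ctr  sending every vertex
-- to the center of the (unique) star containing it.  The star centered
-- at c is {c} ∪ {v | ctr v ≡ c}, with edges {c,v} for its satellites.

starSize : ∀ {n} → (Fin n → Fin n) → Fin n → ℕ
starSize {n} ctr c = length (filter (λ v → ctr v ≟ c) (allFin n))

record StarPartition {n : ℕ} (k : ℕ) (G : Graph n) : Set where
  field
    ctr      : Fin n → Fin n
    ctr-idem : ∀ v → ctr (ctr v) ≡ ctr v
    ctr-adj  : ∀ v → v ≢ ctr v → Adj G v (ctr v)
    size-≤   : ∀ v → starSize ctr (ctr v) ≤ k
open StarPartition public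

module _ {n k : ℕ} {G : Graph n} (P : StarPartition k G) where

  sizeOf : Fin n → ℕ
  sizeOf v = starSize (ctr P) (ctr P v)

  IsCenter : Fin n → Set
  IsCenter v = ctr P v ≡ v

  IsSatellite : Fin n → Set
  IsSatellite v = ctr P v ≢ v

  numStars : ℕ
  numStars = length (filter (λ c → ctr P c ≟ c) (allFin n))

  numOneStars : ℕ
  numOneStars =
    length (filter (λ c → (ctr P c ≟ c) ×-dec (starSize (ctr P) c ℕ.≟ 1)) (allFin n))

  Critical : Fin n → Set
  Critical v = sizeOf v ≡ 2 ⊎ (ctr P v ≡ v × sizeOf v ≡ 3)

  critical? : (v : Fin n) → Dec (Critical v)
  critical? v = (sizeOf v ℕ.≟ 2) ⊎-dec ((ctr P v ≟ v) ×-dec (sizeOf v ℕ.≟ 3))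

  Separate : Fin n → Fin n → Set
  Separate u v = ctr P u ≢ ctr P v

  Op1Applicable : Set
  Op1Applicable =
    Σ (Fin n) λ u → Σ (Fin n) λ v →
      Adj G u v × sizeOf u ≡ 2 × IsSatellite v × 4 ≤ sizeOf v

  Op2Applicable : Set
  Op2Applicable =
    Σ (Fin n) λ c → IsCenter c ×
      (starSize (ctr P) c ≡ 2 ⊎ starSize (ctr P) c ≡ 3 ⊎ starSize (ctr P) c ≡ 4) ×
      Σ (Fin n → Fin n) λ w →
        (∀ x → ctr P x ≡ c → Critical (w x) × ctr P (w x) ≢ c × Adj G x (w x)) ×
        (∀ x y → ctr P x ≡ c → ctr P y ≡ c → x ≢ y → Separate (w x) (w y))

  Op3Applicable : Set
  Op3Applicable =
    Σ (Fin n) λ c → IsCenter c ×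
      (starSize (ctr P) c ≡ 2 ⊎ starSize (ctr P) c ≡ 3) ×
      Σ (Fin n) λ w₁ → Σ (Fin n) λ w₂ →
        w₁ ≢ w₂ × ctr P w₁ ≡ ctr P w₂ × sizeOf w₁ ≡ 2 × ctr P w₁ ≢ c ×
        Adj G w₁ c × Adj G w₂ c ×
        ( (5 ≤ k ⊎ starSize (ctr P) c ≡ 2)
        ⊎ (k ≡ 4 × starSize (ctr P) c ≡ 3 ×
            Σ (Fin n) λ w₃ → Σ (Fin n) λ vⱼ →
              Critical w₃ × ctr P w₃ ≢ c × ctr P w₃ ≢ ctr P w₁ ×
              ctr P vⱼ ≡ c × vⱼ ≢ c × Adj G w₃ vⱼ))

-- 1/m for m ≥ 1 (value at 0 is irrelevant and never used)
1/ : ℕ → ℚ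
1/ zero    = 0ℚ
1/ (suc m) = + 1 ℚ./ suc m

ℕ→ℚ : ℕ → ℚ
ℕ→ℚ m = + m ℚ./ 1

α : ℕ → ℚ
α k = (ℕ→ℚ (2 ℕ.* k) ℚ.- ℕ→ℚ 3) ℚ.* 1/ (2 ℕ.* k ℕ.* k ℕ.∸ 4 ℕ.* k ℕ.+ 1)

module _ {n k : ℕ} {G : Graph n} (S Q : StarPartition k G) where

  someSatCritical : Fin n → Bool
  someSatCritical c =
    any (λ x → ⌊ ctr Q x ≟ c ⌋ ∧ not ⌊ x ≟ c ⌋ ∧ ⌊ critical? S x ⌋) (allFin n)

  token : Fin n → ℚ
  token v with sizeOf Q v
  ... | zero  = α k   -- impossible (every star has ≥ 1 vertex)
  ... | suc zero = α k
  ... | j@(suc (suc _)) =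
    if ⌊ critical? S (ctr Q v) ⌋
      then (if ⌊ v ≟ ctr Q v ⌋ then α k
            else (1ℚ ℚ.- α k) ℚ.* 1/ (j ∸ 1))
    else if someSatCritical (ctr Q v)
      then (if ⌊ v ≟ ctr Q v ⌋ then 1ℚ ℚ.- ℕ→ℚ (j ∸ 1) ℚ.* α k
            else α k)
    else 1/ j

{-# OPTIONS --safe #-}
-- The bounds follow from the token rules alone, for arbitrary partitions S and Q.  Writing
-- D = 2k² − 4k + 1, we have α = (2k − 3)/D, (1 − α)/(k − 1) = 2(k − 2)/D and
-- 1 − (k − 1)α = (k − 2)/D, so the satellite bound (1 − α)/(k − 1) lies below α and 1/k,
-- and the centre bound 1 − (k − 1)α lies below the satellite bound.  As 0 ≤ α ≤ 1, the
-- shares (1 − α)/(j − 1) and 1 − (j − 1)α of a j-star with j ≤ k are smallest at j = k.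
-- A vertex receiving 1 − (j − 1)α is a centre that is not critical, so it is exempt from
-- the satellite bound.
module Submission where

open import Defs hiding (sym)
open import Data.Nat using (ℕ; _≤_; _∸_)
open import Data.Fin using (Fin)
open import Data.Product using (_×_)
open import Data.Sum using (_⊎_)
open import Relation.Nullary using (¬_)
open import Data.Rational as ℚ using (1ℚ)

open import Data.Bool using (true; false)
open import Data.Empty using (⊥-elim)
open import Data.Fin.Properties using (_≟_)
open import Data.Integer as ℤ using (+_)
import Data.Integer.Properties as ℤP
import Data.Nat as ℕ
open import Data.Nat using (suc; z≤n; s≤s)
import Data.Nat.Properties as ℕP
open import Data.Nat.Tactic.RingSolver using (solve-∀)
open import Data.Product using (_,_)
open import Data.Rational using (ℚ; toℚᵘ)
import Data.Rational.Properties as ℚP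
open import Algebra.Properties.AbelianGroup ℚP.+-0-abelianGroup using (xyx⁻¹≈y)
open import Data.Rational.Unnormalised as ℚᵘ using (mkℚᵘ; *≡*; *≤*) renaming (_≃_ to _≃ᵘ_)
import Data.Rational.Unnormalised.Properties as ℚᵘP
open import Data.Sum using ([_,_]′)
open import Function using (_∘_)
open import Relation.Nullary using (yes; no)
open import Relation.Binary.PropositionalEquality

toℚᵘ-/ : ∀ i b → toℚᵘ (i ℚ./ suc b) ≃ᵘ mkℚᵘ i b
toℚᵘ-/ i b = ℚP.toℚᵘ-fromℚᵘ (mkℚᵘ i b)

/-cross-≡ : ∀ a b c d → a ℕ.* suc d ≡ c ℕ.* suc b → + a ℚ./ suc b ≡ + c ℚ./ suc d
/-cross-≡ a b c d eq = ℚP.toℚᵘ-injective (begin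
  toℚᵘ (+ a ℚ./ suc b) ≈⟨ toℚᵘ-/ (+ a) b ⟩
  mkℚᵘ (+ a) b          ≈⟨ *≡* (trans (sym (ℤP.pos-* a (suc d))) (trans (cong +_ eq) (ℤP.pos-* c (suc b)))) ⟩
  mkℚᵘ (+ c) d          ≈⟨ toℚᵘ-/ (+ c) d ⟨
  toℚᵘ (+ c ℚ./ suc d) ∎)
  where open ℚᵘP.≃-Reasoning

/-cross-≤ : ∀ a b c d → a ℕ.* suc d ≤ c ℕ.* suc b → + a ℚ./ suc b ℚ.≤ + c ℚ./ suc d
/-cross-≤ a b c d le = ℚP.toℚᵘ-cancel-≤ (begin
  toℚᵘ (+ a ℚ./ suc b) ≃⟨ toℚᵘ-/ (+ a) b ⟩
  mkℚᵘ (+ a) b          ≤⟨ *≤* (subst₂ ℤ._≤_ (ℤP.pos-* a (suc d)) (ℤP.pos-* c (suc b)) (ℤ.+≤+ le)) ⟩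
  mkℚᵘ (+ c) d          ≃⟨ toℚᵘ-/ (+ c) d ⟨
  toℚᵘ (+ c ℚ./ suc d) ∎)
  where open ℚᵘP.≤-Reasoning

/+/ : ∀ a b c d → + a ℚ./ suc b ℚ.+ + c ℚ./ suc d ≡ + (a ℕ.* suc d ℕ.+ c ℕ.* suc b) ℚ./ (suc b ℕ.* suc d)
/+/ a b c d = ℚP.toℚᵘ-injective (begin
  toℚᵘ (+ a ℚ./ suc b ℚ.+ + c ℚ./ suc d)          ≈⟨ ℚP.toℚᵘ-homo-+ (+ a ℚ./ suc b) (+ c ℚ./ suc d) ⟩
  toℚᵘ (+ a ℚ./ suc b) ℚᵘ.+ toℚᵘ (+ c ℚ./ suc d) ≈⟨ ℚᵘP.+-cong (toℚᵘ-/ (+ a) b) (toℚᵘ-/ (+ c) d) ⟩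
  mkℚᵘ (+ a) b ℚᵘ.+ mkℚᵘ (+ c) d                  ≈⟨ ℚᵘP.≃-reflexive (cong (λ i → mkℚᵘ i _) numerator) ⟩
  mkℚᵘ (+ (a ℕ.* suc d ℕ.+ c ℕ.* suc b)) _       ≈⟨ toℚᵘ-/ _ _ ⟨
  toℚᵘ (+ (a ℕ.* suc d ℕ.+ c ℕ.* suc b) ℚ./ (suc b ℕ.* suc d)) ∎)
  where
  open ℚᵘP.≃-Reasoning
  numerator : + a ℤ.* + suc d ℤ.+ + c ℤ.* + suc b ≡ + (a ℕ.* suc d ℕ.+ c ℕ.* suc b)
  numerator = sym (trans (ℤP.pos-+ (a ℕ.* suc d) (c ℕ.* suc b))
                         (cong₂ ℤ._+_ (ℤP.pos-* a (suc d)) (ℤP.pos-* c (suc b))))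

/*/ : ∀ a b c d → (+ a ℚ./ suc b) ℚ.* (+ c ℚ./ suc d) ≡ + (a ℕ.* c) ℚ./ (suc b ℕ.* suc d)
/*/ a b c d = ℚP.toℚᵘ-injective (begin
  toℚᵘ ((+ a ℚ./ suc b) ℚ.* (+ c ℚ./ suc d))     ≈⟨ ℚP.toℚᵘ-homo-* (+ a ℚ./ suc b) (+ c ℚ./ suc d) ⟩
  toℚᵘ (+ a ℚ./ suc b) ℚᵘ.* toℚᵘ (+ c ℚ./ suc d) ≈⟨ ℚᵘP.*-cong (toℚᵘ-/ (+ a) b) (toℚᵘ-/ (+ c) d) ⟩
  mkℚᵘ (+ a) b ℚᵘ.* mkℚᵘ (+ c) d                  ≈⟨ ℚᵘP.≃-reflexive (cong (λ i → mkℚᵘ i _) (sym (ℤP.pos-* a c))) ⟩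
  mkℚᵘ (+ (a ℕ.* c)) _                            ≈⟨ toℚᵘ-/ _ _ ⟨
  toℚᵘ (+ (a ℕ.* c) ℚ./ (suc b ℕ.* suc d)) ∎)
  where open ℚᵘP.≃-Reasoning

/-/ : ∀ a b c d → b ℕ.+ c ≡ a → + a ℚ./ suc d ℚ.- + b ℚ./ suc d ≡ + c ℚ./ suc d
/-/ a b c d b+c≡a = begin
  + a ℚ./ suc d ℚ.- + b ℚ./ suc d                    ≡⟨ cong (ℚ._- + b ℚ./ suc d) (sym b/d+c/d≡a/d) ⟩
  + b ℚ./ suc d ℚ.+ + c ℚ./ suc d ℚ.- + b ℚ./ suc d ≡⟨ xyx⁻¹≈y (+ b ℚ./ suc d) (+ c ℚ./ suc d) ⟩
  + c ℚ./ suc d                                      ∎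
  where
  open ≡-Reasoning
  cross : ∀ b c e → (b ℕ.* e ℕ.+ c ℕ.* e) ℕ.* e ≡ (b ℕ.+ c) ℕ.* (e ℕ.* e)
  cross = solve-∀
  b/d+c/d≡a/d : + b ℚ./ suc d ℚ.+ + c ℚ./ suc d ≡ + a ℚ./ suc d
  b/d+c/d≡a/d = trans (/+/ b d c d) (/-cross-≡ (b ℕ.* suc d ℕ.+ c ℕ.* suc d) (d ℕ.+ d ℕ.* suc d) a d
    (trans (cross b c (suc d)) (cong (ℕ._* (suc d ℕ.* suc d)) b+c≡a)))

1-/ : ∀ a b d → a ℕ.+ b ≡ suc d → 1ℚ ℚ.- + a ℚ./ suc d ≡ + b ℚ./ suc d
1-/ a b d a+b≡d = trans (cong (ℚ._- + a ℚ./ suc d) (/-cross-≡ 1 0 (suc d) d (ℕP.*-comm 1 (suc d))))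
                        (/-/ (suc d) a b d a+b≡d)

ℕ→ℚ*/ : ∀ c a d → ℕ→ℚ c ℚ.* (+ a ℚ./ suc d) ≡ + (c ℕ.* a) ℚ./ suc d
ℕ→ℚ*/ c a d = trans (/*/ c 0 a d)
  (/-cross-≡ (c ℕ.* a) (d ℕ.+ 0) (c ℕ.* a) d (cong (c ℕ.* a ℕ.*_) (sym (ℕP.+-identityʳ (suc d)))))

/*1/-cancel : ∀ a c d → (+ (a ℕ.* suc c) ℚ./ suc d) ℚ.* 1/ (suc c) ≡ + a ℚ./ suc d
/*1/-cancel a c d = trans (/*/ (a ℕ.* suc c) d 1 c)
  (/-cross-≡ (a ℕ.* suc c ℕ.* 1) (c ℕ.+ d ℕ.* suc c) a d (cancel a (suc c) (suc d)))
  where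
  cancel : ∀ a c e → a ℕ.* c ℕ.* 1 ℕ.* e ≡ a ℕ.* (e ℕ.* c)
  cancel = solve-∀

ℕ→ℚ-mono-≤ : ∀ {a b} → a ≤ b → ℕ→ℚ a ℚ.≤ ℕ→ℚ b
ℕ→ℚ-mono-≤ {a} {b} a≤b = /-cross-≤ a 0 b 0 (ℕP.*-monoˡ-≤ 1 a≤b)

1/-antimono-≤ : ∀ {a b} → a ≤ b → 1/ (suc b) ℚ.≤ 1/ (suc a)
1/-antimono-≤ {a} {b} a≤b = /-cross-≤ 1 b 1 a (ℕP.*-monoʳ-≤ 1 (s≤s a≤b))

satelliteShare : ℕ → ℕ → ℚ
satelliteShare k j = (1ℚ ℚ.- α k) ℚ.* 1/ (j ∸ 1)

centreShare : ℕ → ℕ → ℚ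
centreShare k j = 1ℚ ℚ.- ℕ→ℚ (j ∸ 1) ℚ.* α k

token-≥ : ∀ {n k} {G : Graph n} (S Q : StarPartition k G) (v : Fin n) {b : ℚ}
  → b ℚ.≤ α k
  → (∀ {j} → 2 ≤ j → j ≤ k → b ℚ.≤ satelliteShare k j)
  → (∀ {j} → 2 ≤ j → j ≤ k → b ℚ.≤ 1/ j)
  → (v ≡ ctr Q v → ¬ Critical S v → ∀ {j} → j ≤ k → b ℚ.≤ centreShare k j)
  → b ℚ.≤ token S Q v
token-≥ S Q v b≤α b≤satellite b≤1/j b≤centre with sizeOf Q v | size-≤ Q v
... | 0 | _ = b≤α
... | 1 | _ = b≤α
... | suc (suc _) | j≤k with critical? S (ctr Q v) | v ≟ ctr Q v
...   | yes _ | yes _ = b≤α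
...   | yes _ | no _  = b≤satellite (s≤s (s≤s z≤n)) j≤k
...   | no ¬crit | v≟c with someSatCritical S Q (ctr Q v) | v≟c
...     | false | _        = b≤1/j (s≤s (s≤s z≤n)) j≤k
...     | true  | yes v≡c = b≤centre v≡c (¬crit ∘ subst (Critical S) v≡c) j≤k
...     | true  | no _     = b≤α

-- k = 2 + m, and suc d = 2k² − 4k + 1 is the common denominator of α and both shares.
module Bounds (m : ℕ) where

  private
    k d : ℕ
    k = 2 ℕ.+ m
    d = 2 ℕ.* m ℕ.* (2 ℕ.+ m)

  α≡ : α k ≡ + (1 ℕ.+ 2 ℕ.* m) ℚ./ suc d
  α≡ = begin
    α k                                  ≡⟨ cong₂ ℚ._*_ (/-/ (2 ℕ.* k) 3 (1 ℕ.+ 2 ℕ.* m) 0 (numerator m)) (cong 1/ denominator) ⟩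
    ℕ→ℚ (1 ℕ.+ 2 ℕ.* m) ℚ.* 1/ (suc d) ≡⟨ ℕ→ℚ*/ (1 ℕ.+ 2 ℕ.* m) 1 d ⟩
    + ((1 ℕ.+ 2 ℕ.* m) ℕ.* 1) ℚ./ suc d ≡⟨ cong (λ x → + x ℚ./ suc d) (ℕP.*-identityʳ (1 ℕ.+ 2 ℕ.* m)) ⟩
    + (1 ℕ.+ 2 ℕ.* m) ℚ./ suc d         ∎
    where
    open ≡-Reasoning
    numerator : ∀ m → 3 ℕ.+ (1 ℕ.+ 2 ℕ.* m) ≡ 2 ℕ.* (2 ℕ.+ m)
    numerator = solve-∀
    expand : ∀ m → 2 ℕ.* (2 ℕ.+ m) ℕ.* (2 ℕ.+ m) ≡ 2 ℕ.* m ℕ.* (2 ℕ.+ m) ℕ.+ 4 ℕ.* (2 ℕ.+ m)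
    expand = solve-∀
    denominator : 2 ℕ.* k ℕ.* k ∸ 4 ℕ.* k ℕ.+ 1 ≡ suc d
    denominator = trans (cong (λ x → x ∸ 4 ℕ.* k ℕ.+ 1) (expand m))
                        (trans (cong (ℕ._+ 1) (ℕP.m+n∸n≡m d (4 ℕ.* k))) (ℕP.+-comm d 1))

  1-α≡ : 1ℚ ℚ.- α k ≡ + (2 ℕ.* m ℕ.* suc m) ℚ./ suc d
  1-α≡ = trans (cong (λ x → 1ℚ ℚ.- x) α≡) (1-/ (1 ℕ.+ 2 ℕ.* m) (2 ℕ.* m ℕ.* suc m) d (split m))
    where
    split : ∀ m → 1 ℕ.+ 2 ℕ.* m ℕ.+ 2 ℕ.* m ℕ.* suc m ≡ suc (2 ℕ.* m ℕ.* (2 ℕ.+ m))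
    split = solve-∀

  satelliteShare≡ : satelliteShare k k ≡ + (2 ℕ.* m) ℚ./ suc d
  satelliteShare≡ = trans (cong (ℚ._* 1/ (suc m)) 1-α≡) (/*1/-cancel (2 ℕ.* m) m d)

  centreShare≡ : centreShare k k ≡ + m ℚ./ suc d
  centreShare≡ = begin
    1ℚ ℚ.- ℕ→ℚ (suc m) ℚ.* α k                           ≡⟨ cong (λ x → 1ℚ ℚ.- ℕ→ℚ (suc m) ℚ.* x) α≡ ⟩
    1ℚ ℚ.- ℕ→ℚ (suc m) ℚ.* (+ (1 ℕ.+ 2 ℕ.* m) ℚ./ suc d) ≡⟨ cong (λ x → 1ℚ ℚ.- x) (ℕ→ℚ*/ (suc m) (1 ℕ.+ 2 ℕ.* m) d) ⟩
    1ℚ ℚ.- + (suc m ℕ.* (1 ℕ.+ 2 ℕ.* m)) ℚ./ suc d       ≡⟨ 1-/ (suc m ℕ.* (1 ℕ.+ 2 ℕ.* m)) m d (split m) ⟩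
    + m ℚ./ suc d                                          ∎
    where
    open ≡-Reasoning
    split : ∀ m → suc m ℕ.* (1 ℕ.+ 2 ℕ.* m) ℕ.+ m ≡ suc (2 ℕ.* m ℕ.* (2 ℕ.+ m))
    split = solve-∀

  satelliteShare≤α : satelliteShare k k ℚ.≤ α k
  satelliteShare≤α = begin
    satelliteShare k k          ≡⟨ satelliteShare≡ ⟩
    + (2 ℕ.* m) ℚ./ suc d       ≤⟨ /-cross-≤ (2 ℕ.* m) d (1 ℕ.+ 2 ℕ.* m) d (ℕP.*-monoˡ-≤ (suc d) (ℕP.n≤1+n (2 ℕ.* m))) ⟩
    + (1 ℕ.+ 2 ℕ.* m) ℚ./ suc d ≡⟨ α≡ ⟨
    α k                         ∎
    where open ℚP.≤-Reasoning

  satelliteShare≤1/ : ∀ {j} → 2 ≤ j → j ≤ k → satelliteShare k k ℚ.≤ 1/ j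
  satelliteShare≤1/ {suc j} _ (s≤s j≤k) = begin
    satelliteShare k k    ≡⟨ satelliteShare≡ ⟩
    + (2 ℕ.* m) ℚ./ suc d ≤⟨ /-cross-≤ (2 ℕ.* m) d 1 (suc m) (subst (d ≤_) (sym (ℕP.*-identityˡ (suc d))) (ℕP.n≤1+n d)) ⟩
    1/ k                  ≤⟨ 1/-antimono-≤ j≤k ⟩
    1/ (suc j)            ∎
    where open ℚP.≤-Reasoning

  centreShare≤satelliteShare : centreShare k k ℚ.≤ satelliteShare k k
  centreShare≤satelliteShare = begin
    centreShare k k       ≡⟨ centreShare≡ ⟩
    + m ℚ./ suc d         ≤⟨ /-cross-≤ m d (2 ℕ.* m) d (ℕP.*-monoˡ-≤ (suc d) (ℕP.m≤m+n m (m ℕ.+ 0))) ⟩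
    + (2 ℕ.* m) ℚ./ suc d ≡⟨ satelliteShare≡ ⟨
    satelliteShare k k    ∎
    where open ℚP.≤-Reasoning

  satelliteShare-antimono : ∀ {j} → 2 ≤ j → j ≤ k → satelliteShare k k ℚ.≤ satelliteShare k j
  satelliteShare-antimono (s≤s (s≤s _)) (s≤s j≤k) =
    ℚP.*-monoˡ-≤-nonNeg (1ℚ ℚ.- α k) {{1-α≥0}} (1/-antimono-≤ (ℕP.≤-pred j≤k))
    where
    1-α≥0 : ℚ.NonNegative (1ℚ ℚ.- α k)
    1-α≥0 = subst ℚ.NonNegative (sym 1-α≡) (ℚP.normalize-nonNeg (2 ℕ.* m ℕ.* suc m) (suc d))

  centreShare-antimono : ∀ {j} → j ≤ k → centreShare k k ℚ.≤ centreShare k j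
  centreShare-antimono j≤k =
    ℚP.+-monoʳ-≤ 1ℚ (ℚP.neg-antimono-≤ (ℚP.*-monoʳ-≤-nonNeg (α k) {{α≥0}} (ℕ→ℚ-mono-≤ (ℕP.∸-monoˡ-≤ 1 j≤k))))
    where
    α≥0 : ℚ.NonNegative (α k)
    α≥0 = subst ℚ.NonNegative (sym α≡) (ℚP.normalize-nonNeg (1 ℕ.+ 2 ℕ.* m) (suc d))

lemma6 : (k : ℕ) → 4 ≤ k → (n : ℕ) → (G : Graph n)
    → (S : StarPartition k G)
    → (∀ (P : StarPartition k G) → numOneStars S ≤ numOneStars P)
    → ¬ Op1Applicable S → ¬ Op2Applicable S → ¬ Op3Applicable S
    → (Q : StarPartition k G)
    → (∀ (P : StarPartition k G) → numStars Q ≤ numStars P)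
    → (∀ (v : Fin n) → IsSatellite Q v ⊎ Critical S v
         → (1ℚ ℚ.- α k) ℚ.* 1/ (k ∸ 1) ℚ.≤ token S Q v)
      × (∀ (v : Fin n) → 1ℚ ℚ.- ℕ→ℚ (k ∸ 1) ℚ.* α k ℚ.≤ token S Q v)
lemma6 .(2 ℕ.+ m) (s≤s (s≤s {n = m} _)) n G S _ _ _ _ Q _ = satellite-bound , centre-bound
  where
  open Bounds m
  satellite-bound : ∀ v → IsSatellite Q v ⊎ Critical S v → satelliteShare (2 ℕ.+ m) (2 ℕ.+ m) ℚ.≤ token S Q v
  satellite-bound v sat⊎crit = token-≥ S Q v satelliteShare≤α satelliteShare-antimono satelliteShare≤1/
    (λ v≡c ¬crit → ⊥-elim ([ (λ sat → sat (sym v≡c)) , ¬crit ]′ sat⊎crit))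
  centre-bound : ∀ v → centreShare (2 ℕ.+ m) (2 ℕ.+ m) ℚ.≤ token S Q v
  centre-bound v = token-≥ S Q v
    (below satelliteShare≤α)
    (λ 2≤j j≤k → below (satelliteShare-antimono 2≤j j≤k))
    (λ 2≤j j≤k → below (satelliteShare≤1/ 2≤j j≤k))
    (λ _ _ → centreShare-antimono)
    where
    below : ∀ {q} → satelliteShare (2 ℕ.+ m) (2 ℕ.+ m) ℚ.≤ q → centreShare (2 ℕ.+ m) (2 ℕ.+ m) ℚ.≤ q
    below = ℚP.≤-trans centreShare≤satelliteShare
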